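{- Let $\phi$ be a homogeneous $\textsc{3-xor}$ formula over the variables $X_1,\ldots,X_n$ (in this fixed order) with $m$ pairwise inequivalent clauses, let $G_\phi$ be the graph constructed from $\phi$ as described in the context, and for $1 \le i \le n$ let $\phi_i$ be the system obtained from $\phi$ by adding the equation $X_i = 1$. Let $k \geq 2$. If $\phi_i$ is $3(k+1)$-locally consistent, then $X_i^0 \equiv^k X_i^1$ in $G_\phi$, i.e. the $k$-tuple $(X_i^0,\ldots,X_i^0)$ and the $k$-tuple $(X_i^1,\ldots,X_i^1)$ lie in the same class of the $k$-dimensional Weisfeiler--Leman partition of $V(G_\phi)^k$.
   Context: Graphs are finite, simple, undirected and loopless. A $\textsc{3-xor}$ formula is a finite set of clauses, each consisting of exactly three literals on three distinct variables (a literal is a variable $X$ or its negation $\bar X$); an assignment satisfies a clause if an even number of its literals is true. Equivalently each clause is a linear equation $x+y+z=c$ over $\mathbb{F}_2$, where $c$ is $1$ iff an odd number of the literals are negated; two clauses are equivalent if they give the same equation. A formula is homogeneous if no literal is negated (all right-hand sides are $0$). Construction of $G_\phi$ (for $\phi$ with $n$ variables $X_1,\ldots,X_n$ in this order and $m$ inequivalent clauses): for each clause $C$, whose variables listed in increasing index order are called first, second and third, let $C_{000}=C$, and let $C_{011}$, $C_{110}$, $C_{101}$ be the clauses obtained from $C$ by negating respectively the second and third, the first and second, and the first and third literals. $G_\phi$ has one vertex for each of $C_{000},C_{011},C_{110},C_{101}$ for each clause $C$; two vertices $X^0,X^1$ for each variable $X$; and three vertices $i_l,i_r,i_s$ for each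 $1\le i<n$ (so $4m+2n+3(n-1)$ vertices). Edges: a clause vertex $D$ is adjacent to $X^1$ if the literal $X$ occurs in $D$ and to $X^0$ if the literal $\bar X$ occurs in $D$; $X^0$ is adjacent to $X^1$ for every variable $X$; and for each $1\le i<n$ there are edges $\{i_l,i_r\}$, $\{i_r,i_s\}$, $\{i_l,X_i^0\}$, $\{i_l,X_i^1\}$, $\{i_r,X_{i+1}^0\}$, $\{i_r,X_{i+1}^1\}$. Local consistency: for a system $\psi$ of equations over $\mathbb{F}_2$ and an integer $k$, the $k$-pebble game is played by Spoiler and Verifier with pebbles $p_1,\ldots,p_k$. In each move Spoiler chooses a pebble (already in play or fresh) and places it on a variable of $\psi$, and Verifier responds with a value in $\{0,1\}$ for that variable. Spoiler wins if at some point there is an equation of $\psi$ all of whose variables carry pebbles and the values assigned by Verifier violate it. $\psi$ is $k$-locally consistent if Verifier has a strategy to play forever without Spoiler winning. $k$-dimensional Weisfeiler--Leman ($k\ge 2$): for a graph $G$ with vertex set $V$, the partition of $V^k$ is the coarsest partition $\mathcal{P}$ such that whenever $\bar u,\bar v$ lie in the same part, then the order-preserving map from $\bar u$ to $\bar v$ is an isomorphism of the induced ordered subgraphs, and for every $k$-tuple $(P_1,\ldots,P_k)$ of parts of $\mathcal{P}$, $|\{x \mid \bar u[x/i]\in P_i \text{ for } 1\le i\le k\}| = |\{x \mid \bar v[x/i]\in P_i \text{ for } 1\le i\le k\}|$, where $\bar u[x/i]$ is $\bar u$ with its $i$-th entry replaced by $x$. $\equiv^k$ denotes the corresponding equivalence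 relation. -}

module Defs where

open import Data.Nat using (ℕ; zero; suc; pred)
open import Data.Fin using (Fin; zero; suc; inject₁; _<_; _≟_)
open import Data.Fin.Properties using (all?)
open import Data.Bool using (Bool; true; false; not; if_then_else_; _xor_)
open import Data.Maybe using (Maybe; just; nothing)
open import Data.List using (List; []; _∷_; _++_; map; concatMap; length; filter; foldr)
open import Data.List.Membership.Propositional using (_∈_)
open import Data.Product using (Σ; ∃; _×_; _,_)
open import Data.Sum using (_⊎_)
open import Relation.Nullary using (¬_; does)
open import Relation.Binary.PropositionalEquality using (_≡_; _≢_)
open import Function.Bundles using (_⇔_)
import Data.Nat as ℕ
import Data.Fin as F
open import Data.List using () renaming (allFin to allFinL)

-- Homogeneous 3-XOR formulas over variables X_0,…,X_{n-1} (= X_1..X_n)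

-- A homogeneous clause X_a ⊕ X_b ⊕ X_c = 0 on three distinct variables,
-- listed in increasing index order (first = a, second = b, third = c).
record Clause (n : ℕ) : Set where
  constructor clause
  field
    fst snd thd : Fin n
    fst<snd     : fst < snd
    snd<thd     : snd < thd
open Clause public

-- For homogeneous clauses, two clauses are equivalent iff they have the
-- same variable set, i.e. the same sorted variable triple.
record Formula (n : ℕ) : Set where
  field
    m       : ℕ
    cls     : Fin m → Clause n
    inequiv : ∀ p q → fst (cls p) ≡ fst (cls q) → snd (cls p) ≡ snd (cls q)
              → thd (cls p) ≡ thd (cls q) → p ≡ q
open Formula public

-- An equation  x₁ + … + x_r = rhs  over 𝔽₂ (Bool, true = 1).
record Equation (nv : ℕ) : Set where
  constructor _≐_
  field
    vars : List (Fin nv)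
    rhs  : Bool
open Equation public

System : ℕ → Set
System nv = List (Equation nv)

-- A position of the k-pebble game: for each pebble p_j, either not in play
-- or placed on a variable together with Verifier's value for it.
Position : ℕ → ℕ → Set
Position k nv = Fin k → Maybe (Fin nv × Bool)

move : ∀ {k nv} → Position k nv → Fin k → Fin nv → Bool → Position k nv
move pos j x b j' = if does (j' ≟ j) then just (x , b) else pos j'

data Reads {k nv : ℕ} (pos : Position k nv) : List (Fin nv) → List Bool → Set where
  []  : Reads pos [] []
  _∷_ : ∀ {x b xs bs} → (Σ (Fin k) λ j → pos j ≡ just (x , b))
        → Reads pos xs bs → Reads pos (x ∷ xs) (b ∷ bs)

parity : List Bool → Bool
parity = foldr _xor_ false

Violated : ∀ {k nv} → Position k nv → Equation nv → Set
Violated pos e = Σ (List Bool) λ bs → Reads pos (vars e) bs × parity bs ≢ rhs e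

Inconsistent : ∀ {k nv} → Position k nv → Set
Inconsistent {k} {nv} pos =
  Σ (Fin k) λ j → Σ (Fin k) λ j' → Σ (Fin nv) λ x → Σ Bool λ b → Σ Bool λ b' →
    pos j ≡ just (x , b) × pos j' ≡ just (x , b') × b ≢ b'

SpoilerWins : ∀ {k nv} → System nv → Position k nv → Set
SpoilerWins ψ pos = Inconsistent pos ⊎ (Σ (Equation _) λ e → e ∈ ψ × Violated pos e)

initial : ∀ {k nv} → Position k nv
initial _ = nothing

-- ψ is k-locally consistent: Verifier can play forever, i.e. there is a set
-- S of positions (those reachable under a Verifier strategy) containing the
-- initial position, in which Spoiler never has won, and such that from each
-- position in S, for every Spoiler move Verifier has an answer staying in S.
LocallyConsistent : ∀ {nv} → ℕ → System nv → Set₁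
LocallyConsistent {nv} k ψ =
  Σ (Position k nv → Set) λ S →
    S initial
    × (∀ pos → S pos → ¬ SpoilerWins ψ pos)
    × (∀ pos → S pos → ∀ (j : Fin k) (x : Fin nv) → Σ Bool λ b → S (move pos j x b))

clauseEq : ∀ {n} → Clause n → Equation n
clauseEq C = (fst C ∷ snd C ∷ thd C ∷ []) ≐ false

system : ∀ {n} → Formula n → System n
system φ = map (λ p → clauseEq (cls φ p)) (allFinL (m φ))

system+ : ∀ {n} → Formula n → Fin n → System n
system+ φ i = system φ ++ ((i ∷ []) ≐ true ∷ [])

record FinGraph : Set₁ where
  field
    V    : Set
    allV : List V            -- enumeration of V (each vertex exactly once)
    E    : V → V → Set
open FinGraph public

Tuple : FinGraph → ℕ → Set
Tuple G k = Fin k → V G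

upd : ∀ {G : FinGraph} {k} → Tuple G k → Fin k → V G → Tuple G k
upd u i x j = if does (j ≟ i) then x else u j

-- the order preserving map ū ↦ v̄ is an isomorphism of induced ordered subgraphs
SameType : (G : FinGraph) {k : ℕ} → Tuple G k → Tuple G k → Set
SameType G u v = ∀ i j → (u i ≡ u j ⇔ v i ≡ v j) × (E G (u i) (u j) ⇔ E G (v i) (v j))

-- A partition of V^k is given by a colouring (parts = colour classes).
Colouring : FinGraph → ℕ → Set
Colouring G k = Tuple G k → ℕ

-- |{x | ū[x/i] ∈ P_i for 1 ≤ i ≤ k}| where P_i is the colour class c i
count : ∀ {G : FinGraph} {k} → Colouring G k → Tuple G k → (Fin k → ℕ) → ℕ
count {G} col u c =
  length (filter (λ x → all? (λ i → col (upd {G} u i x) ℕ.≟ c i)) (allV G))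

Stable : (G : FinGraph) (k : ℕ) → Colouring G k → Set
Stable G k col = ∀ u v → col u ≡ col v →
  SameType G u v × (∀ (c : Fin k → ℕ) → count {G} col u c ≡ count {G} col v c)

Coarsest : (G : FinGraph) (k : ℕ) → Colouring G k → Set
Coarsest G k col = Stable G k col ×
  (∀ (col' : Colouring G k) → Stable G k col' → ∀ u v → col' u ≡ col' v → col u ≡ col v)

WLEquiv : (G : FinGraph) (k : ℕ) → Tuple G k → Tuple G k → Set
WLEquiv G k u v = Σ (Colouring G k) λ col → Coarsest G k col × col u ≡ col v

data Variant : Set where
  v000 v011 v110 v101 : Variant

allVariants : List Variant
allVariants = v000 ∷ v011 ∷ v110 ∷ v101 ∷ []

negFst negSnd negThd : Variant → Bool
negFst v000 = false
negFst v011 = false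
negFst v110 = true
negFst v101 = true
negSnd v000 = false
negSnd v011 = true
negSnd v110 = true
negSnd v101 = false
negThd v000 = false
negThd v011 = true
negThd v110 = false
negThd v101 = true

data GT : Set where
  l r s : GT

-- for 1 ≤ i < n (here 0 ≤ i < n-1): X_i and X_{i+1}
lo hi : ∀ {n} → Fin (pred n) → Fin n
lo {suc n} i = inject₁ i
hi {suc n} i = suc i

data Vtx (n m : ℕ) : Set where
  cl  : Fin m → Variant → Vtx n m
  var : Fin n → Bool → Vtx n m             -- var x b = X^b (true = 1)
  gad : Fin (pred n) → GT → Vtx n m

-- directed version of the edge set
data Arc {n : ℕ} (φ : Formula n) : Vtx n (m φ) → Vtx n (m φ) → Set where
  a-fst : ∀ p v → Arc φ (cl p v) (var (fst (cls φ p)) (not (negFst v)))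
  a-snd : ∀ p v → Arc φ (cl p v) (var (snd (cls φ p)) (not (negSnd v)))
  a-thd : ∀ p v → Arc φ (cl p v) (var (thd (cls φ p)) (not (negThd v)))
  a-var : ∀ x → Arc φ (var x false) (var x true)
  a-lr  : ∀ i → Arc φ (gad i l) (gad i r)
  a-rs  : ∀ i → Arc φ (gad i r) (gad i s)
  a-lX  : ∀ i b → Arc φ (gad i l) (var (lo i) b)
  a-rX  : ∀ i b → Arc φ (gad i r) (var (hi i) b)

Gφ : ∀ {n} → Formula n → FinGraph
Gφ {n} φ = record
  { V    = Vtx n (m φ)
  ; allV = concatMap (λ p → map (cl p) allVariants) (allFinL (m φ))
           ++ concatMap (λ x → var x false ∷ var x true ∷ []) (allFinL n)
           ++ concatMap (λ i → gad i l ∷ gad i r ∷ gad i s ∷ []) (allFinL (pred n))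
  ; E    = λ u v → Arc φ u v ⊎ Arc φ v u
  }

-- Values of pebbled variables twist G_φ: X^0 and X^1 are swapped when X has value 1, and a clause
-- vertex C_v moves to the variant whose negation pattern is shifted by the values of its variables.
-- As long as the values are consistent and satisfy the clause equations, a twist preserves equality
-- and adjacency. With three pebbles on the variables of each entry of a k-tuple plus three spare
-- pebbles, "v̄ is ū twisted entrywise by Verifier's answers" is a winning relation for Duplicator in
-- the bijective k-pebble game: the bijection is the twist read off the spare pebbles, and pebbles
-- later placed on the same variables must receive the same answers. Verifier answers 1 on X_i, so the
-- constant tuples of X_i^0 and X_i^1 are related. Duplicator-winning pairs survive every round of
-- colour refinement, whose fixpoint is the coarsest stable colouring.

module Submission where

open import Defs
open import Data.Nat using (ℕ; _≤_; _*_; _+_)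
open import Data.Fin using (Fin)
open import Data.Bool using (true; false)

open import Algebra.Bundles using (CommutativeRing)
open import Data.Bool using (Bool; if_then_else_; not; _xor_)
open import Data.Bool.Properties as Boolₚ
  using (xor-assoc; xor-same; xor-identityʳ; xor-∧-commutativeRing; not-distribˡ-xor)
open import Algebra.Properties.CommutativeSemigroup
  (CommutativeRing.+-commutativeSemigroup xor-∧-commutativeRing) using (interchange)
open import Data.Fin as Fin using (zero; suc)
open import Data.Fin.Patterns using (0F; 1F; 2F)
open import Data.Fin.Properties as Finₚ using (all?)
open import Data.List
  using (List; []; _∷_; [_]; _++_; map; concatMap; filter; length; allFin; cartesianProduct; cartesianProductWith)
open import Data.List.Properties
  using (map-++; filter-accept; filter-reject; filter-none; filter-notAll; filter-≐)
open import Data.List.Membership.Propositional using (_∈_; find; lose)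
open import Data.List.Membership.Propositional.Properties
  using ( ∈-filter⁺; ∈-map⁺; ∈-++⁺ˡ; ∈-++⁺ʳ; ∈-cartesianProduct⁺; ∈-cartesianProductWith⁺
        ; ∈-concatMap⁺; ∈-allFin)
open import Data.List.Relation.Binary.Permutation.Propositional
  using (_↭_; ↭-refl; ↭-trans; ↭-reflexive; swap; prep)
open import Data.List.Relation.Binary.Permutation.Propositional.Properties
  using (↭-length; filter-↭; ++-comm; ++⁺; map⁺)
open import Data.List.Relation.Unary.All as All using (All)
open import Data.List.Relation.Unary.All.Properties using (¬Any⇒All¬; ¬All⇒Any¬)
open import Data.List.Relation.Unary.Any as Any using (Any; here; there; any?)
open import Data.Maybe using (just)
open import Data.Nat as ℕ using (zero; suc; _<_; z≤n; s≤s)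
open import Data.Nat.Properties as ℕₚ using (0≢1+n; ≤-refl; ≤-trans; ≤-pred; n≮0)
open import Data.Product using (Σ; ∃; ∃₂; _×_; _,_; proj₁; proj₂)
import Data.Product.Properties as Prodₚ
open import Data.Sum as Sum using (_⊎_; inj₁; inj₂)
import Data.Sum.Properties as Sumₚ
open import Data.Unit using (⊤; tt)
open import Data.Vec.Functional using (tail) renaming (_∷_ to _◃_)
import Data.Vec.Functional.Relation.Binary.Pointwise.Properties as Pointwise
open import Function using (_∘_; id)
open import Function.Bundles using (_⇔_; mk⇔; Equivalence)
open import Function.Construct.Composition using (_⇔-∘_)
open import Function.Construct.Identity using (⇔-id)
open import Function.Construct.Symmetry using (⇔-sym)
open import Function.Definitions using (Injective)
open import Level using (0ℓ)
open import Relation.Binary using (DecSetoid; DecidableEquality) renaming (Decidable to Decidable₂)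
import Relation.Binary.Construct.On as On
open import Relation.Binary.PropositionalEquality
  using (_≡_; _≢_; _≗_; refl; sym; trans; cong; cong₂; subst; subst₂; module ≡-Reasoning)
open import Relation.Nullary using (Dec; yes; no; does; ¬_; contradiction)
open import Relation.Nullary.Decidable using (map′; _×-dec_; _→-dec_; _⊎-dec_)
open import Relation.Unary using (Pred; Decidable; _⊆_) renaming (_≐_ to _≐ᵤ_)

open Equivalence using (to; from)

_⇔-dec_ : {A B : Set} → Dec A → Dec B → Dec (A ⇔ B)
a? ⇔-dec b? = map′ (λ (f , g) → mk⇔ f g) (λ h → to h , from h) ((a? →-dec b?) ×-dec (b? →-dec a?))

¬→⇒×¬ : ∀ {A B : Set} → Dec A → ¬ (A → B) → A × ¬ B
¬→⇒×¬ (yes a) ¬a→b = a , λ b → ¬a→b (λ _ → b)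
¬→⇒×¬ (no ¬a) ¬a→b = contradiction (λ a → contradiction a ¬a) ¬a→b

≡-dec-via : ∀ {A B : Set} (f : A → B) (g : B → A) → (∀ a → g (f a) ≡ a)
          → DecidableEquality B → DecidableEquality A
≡-dec-via f g g∘f _≟_ a a′ =
  map′ (λ eq → trans (sym (g∘f a)) (trans (cong g eq) (g∘f a′))) (cong f) (f a ≟ f a′)

module _ {A : Set} {P : Pred A 0ℓ} (P? : Decidable P) where

  filter-some⁻ : ∀ {xs} → 0 < length (filter P? xs) → Any P xs
  filter-some⁻ {xs} 0<len with any? P? xs
  ... | yes any = any
  ... | no ¬any rewrite filter-none P? (¬Any⇒All¬ xs ¬any) = contradiction 0<len (λ ())

  length-filter-map : ∀ {X : Set} (f : X → A) xs
                    → length (filter P? (map f xs)) ≡ length (filter (P? ∘ f) xs)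
  length-filter-map f [] = refl
  length-filter-map f (x ∷ xs) with does (P? (f x))
  ... | true  = cong suc (length-filter-map f xs)
  ... | false = length-filter-map f xs

  length-filter-↭ : ∀ {xs ys} → xs ↭ ys → length (filter P? xs) ≡ length (filter P? ys)
  length-filter-↭ = ↭-length ∘ filter-↭ P?

  module _ {x y : A} (Px⇔Py : P x ⇔ P y) where

    length-filter-∷-cong : ∀ {xs ys} → length (filter P? xs) ≡ length (filter P? ys)
                         → length (filter P? (x ∷ xs)) ≡ length (filter P? (y ∷ ys))
    length-filter-∷-cong eq with P? x | P? y
    ... | yes _  | yes _  = cong suc eq
    ... | no _   | no _   = eq
    ... | yes px | no ¬py = contradiction (to Px⇔Py px) ¬py
    ... | no ¬px | yes py = contradiction (from Px⇔Py py) ¬px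

    length-filter-∷-cancel : ∀ {xs ys} → length (filter P? (x ∷ xs)) ≡ length (filter P? (y ∷ ys))
                           → length (filter P? xs) ≡ length (filter P? ys)
    length-filter-∷-cancel eq with P? x | P? y
    ... | yes _  | yes _  = ℕₚ.suc-injective eq
    ... | no _   | no _   = eq
    ... | yes px | no ¬py = contradiction (to Px⇔Py px) ¬py
    ... | no ¬px | yes py = contradiction (from Px⇔Py py) ¬px

module _ {A : Set} {P Q : Pred A 0ℓ} (P? : Decidable P) (Q? : Decidable Q) (P⊆Q : P ⊆ Q) where

  filter-⊆ : ∀ xs → filter P? (filter Q? xs) ≡ filter P? xs
  filter-⊆ [] = refl
  filter-⊆ (x ∷ xs) with Q? x
  ... | no ¬qx = trans (filter-⊆ xs) (sym (filter-reject P? (¬qx ∘ P⊆Q)))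
  ... | yes _ with P? x
  ...   | yes _ = cong (x ∷_) (filter-⊆ xs)
  ...   | no _  = filter-⊆ xs

  length-filter-⊂ : ∀ {xs} → Any (λ x → Q x × ¬ P x) xs → length (filter P? xs) < length (filter Q? xs)
  length-filter-⊂ {xs} any with x , x∈xs , qx , ¬px ← find any rewrite sym (filter-⊆ xs) =
    filter-notAll P? (filter Q? xs) (lose (∈-filter⁺ Q? x∈xs qx) ¬px)

Any⇒∃↭∷ : ∀ {A : Set} {P : Pred A 0ℓ} {ys} → Any P ys → ∃₂ λ y ys′ → P y × ys ↭ y ∷ ys′
Any⇒∃↭∷ (here py) = _ , _ , py , ↭-refl
Any⇒∃↭∷ {ys = x ∷ _} (there any) with y , ys′ , py , ys↭ ← Any⇒∃↭∷ any =
  y , x ∷ ys′ , py , ↭-trans (prep x ys↭) (swap x y ↭-refl)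

module _ (S : DecSetoid 0ℓ 0ℓ) where
  open DecSetoid S using (_≈_; _≟_)
    renaming (Carrier to C; refl to ≈-refl; sym to ≈-sym; trans to ≈-trans)

  respects-⇔ : ∀ {Q : Pred C 0ℓ} → (∀ {a b} → a ≈ b → Q a → Q b) → ∀ {a b} → a ≈ b → Q a ⇔ Q b
  respects-⇔ respQ a≈b = mk⇔ (respQ a≈b) (respQ (≈-sym a≈b))

  SameClassSizes : List C → List C → Set
  SameClassSizes xs ys = ∀ a → length (filter (_≟ a) xs) ≡ length (filter (_≟ a) ys)

  class-member : ∀ {x xs ys} → SameClassSizes (x ∷ xs) ys → ∃₂ λ y ys′ → y ≈ x × ys ↭ y ∷ ys′
  class-member {x} {xs} same = Any⇒∃↭∷ (filter-some⁻ (_≟ x) (subst (0 <_) x-counted (s≤s z≤n)))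
    where x-counted = trans (sym (cong length (filter-accept (_≟ x) {xs = xs} ≈-refl))) (same x)

  sameClassSizes⇒length-filter : ∀ {xs ys} → SameClassSizes xs ys →
    {P : Pred C 0ℓ} (P? : Decidable P) → (∀ {a b} → a ≈ b → P a → P b) →
    length (filter P? xs) ≡ length (filter P? ys)
  sameClassSizes⇒length-filter {[]} {[]} _ _ _ = refl
  sameClassSizes⇒length-filter {[]} {y ∷ ys} same _ _ =
    contradiction (trans (same y) (cong length (filter-accept (_≟ y) ≈-refl))) 0≢1+n
  sameClassSizes⇒length-filter {x ∷ xs} {ys} same {P} P? resp
    with y , ys′ , y≈x , ys↭ ← class-member {x} {xs} {ys} same = begin
      length (filter P? (x ∷ xs))  ≡⟨ length-filter-∷-cong P? (respects-⇔ resp (≈-sym y≈x)) IH ⟩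
      length (filter P? (y ∷ ys′)) ≡⟨ sym (length-filter-↭ P? ys↭) ⟩
      length (filter P? ys)        ∎
    where
    open ≡-Reasoning
    IH = sameClassSizes⇒length-filter {xs} {ys′}
      (λ a → length-filter-∷-cancel (_≟ a)
               (respects-⇔ (λ u≈v u≈a → ≈-trans (≈-sym u≈v) u≈a) (≈-sym y≈x))
               (trans (same a) (length-filter-↭ (_≟ a) ys↭)))
      P? resp

module _ (D : ℕ → ℕ) {Stop : Pred ℕ 0ℓ} (Stop? : Decidable Stop)
         (descends : ∀ t → ¬ Stop t → D (suc t) < D t) where

  eventually : ∃ Stop
  eventually = go (D 0) 0 ≤-refl
    where
    go : ∀ fuel t → D t ≤ fuel → ∃ Stop
    go fuel t Dt≤fuel with Stop? t
    ... | yes stop = t , stop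
    go zero       t Dt≤0      | no ¬stop = contradiction (≤-trans (descends t ¬stop) Dt≤0) n≮0
    go (suc fuel) t Dt≤1+fuel | no ¬stop =
      go fuel (suc t) (≤-pred (≤-trans (descends t ¬stop) Dt≤1+fuel))

module _ {A : Set} where

  firstIndex : {P : Pred A 0ℓ} → Decidable P → List A → ℕ
  firstIndex P? []       = 0
  firstIndex P? (x ∷ xs) = if does (P? x) then 0 else suc (firstIndex P? xs)

  module _ {P Q : Pred A 0ℓ} (P? : Decidable P) (Q? : Decidable Q) where

    firstIndex-≐ : P ≐ᵤ Q → ∀ xs → firstIndex P? xs ≡ firstIndex Q? xs
    firstIndex-≐ P≐Q [] = refl
    firstIndex-≐ P≐Q (x ∷ xs) with P? x | Q? x
    ... | yes _  | yes _  = refl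
    ... | no _   | no _   = cong suc (firstIndex-≐ P≐Q xs)
    ... | yes px | no ¬qx = contradiction (proj₁ P≐Q px) ¬qx
    ... | no ¬px | yes qx = contradiction (proj₂ P≐Q qx) ¬px

    firstIndex-≡⇒common : ∀ {xs} → Any P xs → firstIndex P? xs ≡ firstIndex Q? xs → ∃ λ x → P x × Q x
    firstIndex-≡⇒common {x ∷ xs} any eq with P? x | Q? x
    ... | yes px | yes qx = x , px , qx
    ... | yes _  | no _   = contradiction eq 0≢1+n
    ... | no _   | yes _  = contradiction (sym eq) 0≢1+n
    ... | no ¬px | no _ with any
    ...   | here px    = contradiction px ¬px
    ...   | there any′ = firstIndex-≡⇒common any′ (ℕₚ.suc-injective eq)

map-concatMap-↭ : ∀ {A B : Set} (f : B → B) (g : A → List B) → (∀ a → map f (g a) ↭ g a)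
                → ∀ xs → map f (concatMap g xs) ↭ concatMap g xs
map-concatMap-↭ f g fix [] = ↭-refl
map-concatMap-↭ f g fix (x ∷ xs) =
  ↭-trans (↭-reflexive (map-++ f (g x) (concatMap g xs))) (++⁺ (fix x) (map-concatMap-↭ f g fix xs))

module WeisfeilerLeman (G : FinGraph) (k : ℕ) (_≟ᵥ_ : DecidableEquality (V G))
  (E? : Decidable₂ (E G)) (∈-allV : ∀ x → x ∈ allV G) where

  Tup : Set
  Tup = Tuple G k

  allTuples : ∀ d → List (Fin d → V G)
  allTuples zero    = [ (λ ()) ]
  allTuples (suc d) = cartesianProductWith _◃_ (allV G) (allTuples d)

  ∈-allTuples : ∀ {d} (u : Fin d → V G) → ∃ λ w → w ∈ allTuples d × w ≗ u
  ∈-allTuples {zero}  u = _ , here refl , λ ()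
  ∈-allTuples {suc d} u with w , w∈ , w≗u ← ∈-allTuples (tail u) =
    u zero ◃ w , ∈-cartesianProductWith⁺ _◃_ (∈-allV (u zero)) w∈ , λ { zero → refl ; (suc i) → w≗u i }

  allT : List Tup
  allT = allTuples k

  sameType? : ∀ u v → Dec (SameType G {k} u v)
  sameType? u v = all? λ i → all? λ j →
    ((u i ≟ᵥ u j) ⇔-dec (v i ≟ᵥ v j)) ×-dec (E? (u i) (u j) ⇔-dec E? (v i) (v j))

  SameType-refl : ∀ u → SameType G {k} u u
  SameType-refl u i j = ⇔-id _ , ⇔-id _

  SameType-sym : ∀ {u v} → SameType G {k} u v → SameType G {k} v u
  SameType-sym st i j = ⇔-sym (proj₁ (st i j)) , ⇔-sym (proj₂ (st i j))

  SameType-trans : ∀ {u v w} → SameType G {k} u v → SameType G {k} v w → SameType G {k} u w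
  SameType-trans st st′ i j = proj₁ (st′ i j) ⇔-∘ proj₁ (st i j) , proj₂ (st′ i j) ⇔-∘ proj₂ (st i j)

  ≗⇒SameType : ∀ {u u′} → u ≗ u′ → SameType G {k} u u′
  ≗⇒SameType u≗u′ i j = transport _≡_ , transport (E G)
    where
    transport : (R : V G → V G → Set) → R _ _ ⇔ R _ _
    transport R = mk⇔ (subst₂ R (u≗u′ i) (u≗u′ j)) (subst₂ R (sym (u≗u′ i)) (sym (u≗u′ j)))

  upd-≗ : ∀ {u u′ : Tup} i x → u ≗ u′ → upd {G} u i x ≗ upd {G} u′ i x
  upd-≗ i x u≗u′ j with does (j Fin.≟ i)
  ... | true  = refl
  ... | false = u≗u′ j

  colours : Colouring G k → Tup → V G → Fin k → ℕ
  colours col u x i = col (upd {G} u i x)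

  fitsColours? : ∀ col u c x → Dec (colours col u x ≗ c)
  fitsColours? col u c x = all? λ i → col (upd {G} u i x) ℕ.≟ c i

  count-cong-colours : ∀ col u {c c′} → c ≗ c′ → count {G} col u c ≡ count {G} col u c′
  count-cong-colours col u {c} {c′} c≗c′ =
    cong length (filter-≐ (fitsColours? col u c) (fitsColours? col u c′)
      ((λ eq i → trans (eq i) (c≗c′ i)) , (λ eq i → trans (eq i) (sym (c≗c′ i)))) (allV G))

  count-cong-tuple : ∀ col → (∀ {w w′} → w ≗ w′ → col w ≡ col w′) → ∀ {u u′} → u ≗ u′ → ∀ c
                   → count {G} col u c ≡ count {G} col u′ c
  count-cong-tuple col col-≗ {u} {u′} u≗u′ c =
    cong length (filter-≐ (fitsColours? col u c) (fitsColours? col u′ c)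
      ( (λ eq i → trans (sym (col-≗ (upd-≗ i _ u≗u′))) (eq i))
      , (λ eq i → trans (col-≗ (upd-≗ i _ u≗u′)) (eq i))) (allV G))

  count-realised : ∀ col u c → count {G} col u c ≡ 0 ⊎ ∃ λ x → c ≗ colours col u x
  count-realised col u c with any? (fitsColours? col u c) (allV G)
  ... | yes any = let x , _ , eq = find any in inj₂ (x , λ i → sym (eq i))
  ... | no ¬any = inj₁ (cong length (filter-none (fitsColours? col u c) (¬Any⇒All¬ (allV G) ¬any)))

  SameCounts : Colouring G k → Tup → Tup → Set
  SameCounts col u v = ∀ c → count {G} col u c ≡ count {G} col v c

  sameCount-cong : ∀ col {u v c c′} → c ≗ c′ → count {G} col u c′ ≡ count {G} col v c′
                 → count {G} col u c ≡ count {G} col v c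
  sameCount-cong col {u} {v} c≗c′ eq =
    trans (count-cong-colours col u c≗c′) (trans eq (sym (count-cong-colours col v c≗c′)))

  -- Any other colour vector is counted 0 around both u and v.
  candidates : Colouring G k → Tup → Tup → List (Fin k → ℕ)
  candidates col u v = map (colours col u) (allV G) ++ map (colours col v) (allV G)

  candidates-suffice : ∀ col u v → All (λ c → count {G} col u c ≡ count {G} col v c) (candidates col u v)
                     → SameCounts col u v
  candidates-suffice col u v same c with count-realised col u c | count-realised col v c
  ... | inj₂ (x , c≗) | _ =
    sameCount-cong col c≗ (All.lookup same (∈-++⁺ˡ (∈-map⁺ (colours col u) (∈-allV x))))
  ... | inj₁ _ | inj₂ (x , c≗) =
    sameCount-cong col c≗ (All.lookup same (∈-++⁺ʳ _ (∈-map⁺ (colours col v) (∈-allV x))))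
  ... | inj₁ u0 | inj₁ v0 = trans u0 (sym v0)

  sameCounts? : ∀ col u v → Dec (SameCounts col u v)
  sameCounts? col u v = map′ (candidates-suffice col u v) (λ same → All.tabulate λ {c} _ → same c)
    (All.all? (λ c → count {G} col u c ℕ.≟ count {G} col v c) (candidates col u v))

  sameCounts-coarser : ∀ {col col′} → (∀ {w w′} → col′ w ≡ col′ w′ → col w ≡ col w′)
                     → ∀ {u v} → SameCounts col′ u v → SameCounts col u v
  sameCounts-coarser {col} {col′} coarser {u} {v} same c = begin
      count {G} col u c                        ≡⟨ sym (length-filter-map (fits c) (around u) (allV G)) ⟩
      length (filter (fits c) (neighbours u))  ≡⟨ sameClassSizes⇒length-filter byColour′
                                                    {neighbours u} {neighbours v} classes
                                                    (fits c) (λ {a} {b} → resp c {a} {b}) ⟩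
      length (filter (fits c) (neighbours v))  ≡⟨ length-filter-map (fits c) (around v) (allV G) ⟩
      count {G} col v c                        ∎
    where
    open ≡-Reasoning
    around : Tup → V G → Fin k → Tup
    around w x i = upd {G} w i x
    neighbours : Tup → List (Fin k → Tup)
    neighbours w = map (around w) (allV G)
    byColour′ : DecSetoid 0ℓ 0ℓ
    byColour′ = On.decSetoid (Pointwise.decSetoid ℕₚ.≡-decSetoid k) (λ y i → col′ (y i))
    open DecSetoid byColour′ using (_≟_)
    fits : ∀ c (y : Fin k → Tup) → Dec (∀ i → col (y i) ≡ c i)
    fits c y = all? λ i → col (y i) ℕ.≟ c i
    classes : SameClassSizes byColour′ (neighbours u) (neighbours v)
    classes a = trans (length-filter-map (_≟ a) (around u) (allV G))
      (trans (same (λ i → col′ (a i))) (sym (length-filter-map (_≟ a) (around v) (allV G))))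
    resp : ∀ c {a b} → (∀ i → col′ (a i) ≡ col′ (b i))
         → (∀ i → col (a i) ≡ c i) → ∀ i → col (b i) ≡ c i
    resp c a≈b fits-a i = trans (sym (coarser (a≈b i))) (fits-a i)

  sameCounts-bijection : ∀ col {u v} (π : V G → V G) → map π (allV G) ↭ allV G
                       → (∀ x → colours col u x ≗ colours col v (π x)) → SameCounts col u v
  sameCounts-bijection col {u} {v} π π-perm same c = begin
      count {G} col u c                          ≡⟨ cong length (filter-≐ (fits u) (fits v ∘ π) moved (allV G)) ⟩
      length (filter (fits v ∘ π) (allV G))      ≡⟨ sym (length-filter-map (fits v) π (allV G)) ⟩
      length (filter (fits v) (map π (allV G)))  ≡⟨ length-filter-↭ (fits v) π-perm ⟩
      count {G} col v c                          ∎
    where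
    open ≡-Reasoning
    fits : ∀ w x → Dec (colours col w x ≗ c)
    fits w = fitsColours? col w c
    moved : (λ x → colours col u x ≗ c) ≐ᵤ (λ x → colours col v (π x) ≗ c)
    moved = (λ fits-u i → trans (sym (same _ i)) (fits-u i)) , (λ fits-v i → trans (same _ i) (fits-v i))

  infix 4 _∼[_]_

  _∼[_]_ : Tup → ℕ → Tup → Set
  ∼? : ∀ t u v → Dec (u ∼[ t ] v)
  colour : ℕ → Colouring G k

  u ∼[ zero ]  v = SameType G {k} u v
  u ∼[ suc t ] v = u ∼[ t ] v × SameCounts (colour t) u v

  ∼? zero    u v = sameType? u v
  ∼? (suc t) u v = ∼? t u v ×-dec sameCounts? (colour t) u v

  colour t u = firstIndex (∼? t u) allT

  ∼-refl : ∀ t u → u ∼[ t ] u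
  ∼-refl zero    u = SameType-refl u
  ∼-refl (suc t) u = ∼-refl t u , λ c → refl

  ∼-sym : ∀ t {u v} → u ∼[ t ] v → v ∼[ t ] u
  ∼-sym zero    st          = SameType-sym st
  ∼-sym (suc t) (∼t , same) = ∼-sym t ∼t , λ c → sym (same c)

  ∼-trans : ∀ t {u v w} → u ∼[ t ] v → v ∼[ t ] w → u ∼[ t ] w
  ∼-trans zero    st          st′           = SameType-trans st st′
  ∼-trans (suc t) (∼t , same) (∼t′ , same′) = ∼-trans t ∼t ∼t′ , λ c → trans (same c) (same′ c)

  colour-sound : ∀ t {u v} → u ∼[ t ] v → colour t u ≡ colour t v
  colour-sound t u∼v = firstIndex-≐ (∼? t _) (∼? t _)
    ((λ u∼w → ∼-trans t (∼-sym t u∼v) u∼w) , (λ v∼w → ∼-trans t u∼v v∼w)) allT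

  ∼-respˡ : ∀ t {u u′ v} → u ≗ u′ → u ∼[ t ] v → u′ ∼[ t ] v
  ≗⇒∼ : ∀ t {u u′} → u ≗ u′ → u ∼[ t ] u′
  colour-≗ : ∀ t {u u′} → u ≗ u′ → colour t u ≡ colour t u′

  ∼-respˡ zero    u≗u′ st          = SameType-trans (SameType-sym (≗⇒SameType u≗u′)) st
  ∼-respˡ (suc t) u≗u′ (∼t , same) =
    ∼-respˡ t u≗u′ ∼t , λ c → trans (sym (count-cong-tuple (colour t) (colour-≗ t) u≗u′ c)) (same c)

  ≗⇒∼ t {u} u≗u′ = ∼-sym t (∼-respˡ t u≗u′ (∼-refl t u))

  colour-≗ t u≗u′ = colour-sound t (≗⇒∼ t u≗u′)

  ∼-resp : ∀ t {u u′ v v′} → u ≗ u′ → v ≗ v′ → u ∼[ t ] v → u′ ∼[ t ] v′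
  ∼-resp t u≗u′ v≗v′ u∼v = ∼-sym t (∼-respˡ t v≗v′ (∼-sym t (∼-respˡ t u≗u′ u∼v)))

  represented : ∀ t u → Any (u ∼[ t ]_) allT
  represented t u with w , w∈ , w≗u ← ∈-allTuples u = lose w∈ (≗⇒∼ t (sym ∘ w≗u))

  colour-complete : ∀ t {u v} → colour t u ≡ colour t v → u ∼[ t ] v
  colour-complete t {u} {v} eq
    with w , u∼w , v∼w ← firstIndex-≡⇒common (∼? t u) (∼? t v) (represented t u) eq =
    ∼-trans t u∼w (∼-sym t v∼w)

  ∼⇒SameType : ∀ t {u v} → u ∼[ t ] v → SameType G {k} u v
  ∼⇒SameType zero    st       = st
  ∼⇒SameType (suc t) (∼t , _) = ∼⇒SameType t ∼t

  pairs : List (Tup × Tup)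
  pairs = cartesianProduct allT allT

  Settled : ℕ → Set
  Settled t = All (λ (u , v) → u ∼[ t ] v → u ∼[ suc t ] v) pairs

  settled? : Decidable Settled
  settled? t = All.all? (λ (u , v) → ∼? t u v →-dec ∼? (suc t) u v) pairs

  #related : ℕ → ℕ
  #related t = length (filter (λ (u , v) → ∼? t u v) pairs)

  #related-decreases : ∀ t → ¬ Settled t → #related (suc t) < #related t
  #related-decreases t unsettled =
    length-filter-⊂ (λ (u , v) → ∼? (suc t) u v) (λ (u , v) → ∼? t u v) proj₁
      (Any.map (λ {(u , v)} → ¬→⇒×¬ (∼? t u v))
        (¬All⇒Any¬ (λ (u , v) → ∼? t u v →-dec ∼? (suc t) u v) pairs unsettled))

  settled⇒∼suc : ∀ {t} → Settled t → ∀ {u v} → u ∼[ t ] v → u ∼[ suc t ] v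
  settled⇒∼suc {t} settled {u} {v} u∼v
    with u′ , u′∈ , u′≗u ← ∈-allTuples u | v′ , v′∈ , v′≗v ← ∈-allTuples v =
    ∼-resp (suc t) u′≗u v′≗v
      (All.lookup settled (∈-cartesianProduct⁺ u′∈ v′∈) (∼-resp t (sym ∘ u′≗u) (sym ∘ v′≗v) u∼v))

  settledAt : ∃ Settled
  settledAt = eventually #related settled? #related-decreases

  t★ : ℕ
  t★ = proj₁ settledAt

  stable : Stable G k (colour t★)
  stable u v eq = ∼⇒SameType (suc t★) u∼v , proj₂ u∼v
    where u∼v = settled⇒∼suc (proj₂ settledAt) (colour-complete t★ eq)

  stable⇒∼ : ∀ {col} → Stable G k col → ∀ t {u v} → col u ≡ col v → u ∼[ t ] v
  stable⇒∼ st zero    {u} {v} eq = proj₁ (st u v eq)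
  stable⇒∼ {col} st (suc t) {u} {v} eq =
    stable⇒∼ st t eq , sameCounts-coarser {colour t} {col} coarser (proj₂ (st u v eq))
    where
    coarser : ∀ {w w′} → col w ≡ col w′ → colour t w ≡ colour t w′
    coarser {w} {w′} eq′ = colour-sound t (stable⇒∼ st t {w} {w′} eq′)

  coarsest : Coarsest G k (colour t★)
  coarsest = stable , λ col st u v eq → colour-sound t★ (stable⇒∼ st t★ eq)

  -- A set of positions closed under Duplicator's moves in the bijective k-pebble game.
  record Bisimulation (R : Tup → Tup → Set) : Set where
    field
      sameType  : ∀ {u v} → R u v → SameType G {k} u v
      bijection : ∀ {u v} → R u v → Σ (V G → V G) λ π → map π (allV G) ↭ allV G
                                    × (∀ i x → R (upd {G} u i x) (upd {G} v i (π x)))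

  module _ {R : Tup → Tup → Set} (bisim : Bisimulation R) where
    open Bisimulation bisim

    bisimilar⇒∼ : ∀ t {u v} → R u v → u ∼[ t ] v
    bisimilar⇒∼ zero    Ruv = sameType Ruv
    bisimilar⇒∼ (suc t) Ruv with π , π-perm , R-upd ← bijection Ruv =
      bisimilar⇒∼ t Ruv ,
      sameCounts-bijection (colour t) π π-perm (λ x i → colour-sound t (bisimilar⇒∼ t (R-upd i x)))

    bisimilar⇒WLEquiv : ∀ {u v} → R u v → WLEquiv G k u v
    bisimilar⇒WLEquiv Ruv = colour t★ , coarsest , colour-sound t★ (bisimilar⇒∼ t★ Ruv)

-- A variant is determined by its first two negation bits; the third is their xor.
mkVariant : Bool → Bool → Variant
mkVariant false false = v000
mkVariant false true  = v011
mkVariant true  true  = v110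
mkVariant true  false = v101

mkVariant-neg : ∀ v → mkVariant (negFst v) (negSnd v) ≡ v
mkVariant-neg v000 = refl
mkVariant-neg v011 = refl
mkVariant-neg v110 = refl
mkVariant-neg v101 = refl

negFst-mkVariant : ∀ a b → negFst (mkVariant a b) ≡ a
negFst-mkVariant false false = refl
negFst-mkVariant false true  = refl
negFst-mkVariant true  true  = refl
negFst-mkVariant true  false = refl

negSnd-mkVariant : ∀ a b → negSnd (mkVariant a b) ≡ b
negSnd-mkVariant false false = refl
negSnd-mkVariant false true  = refl
negSnd-mkVariant true  true  = refl
negSnd-mkVariant true  false = refl

negThd-mkVariant : ∀ a b → negThd (mkVariant a b) ≡ a xor b
negThd-mkVariant false false = refl
negThd-mkVariant false true  = refl
negThd-mkVariant true  true  = refl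
negThd-mkVariant true  false = refl

negThd≡negFst-xor-negSnd : ∀ v → negThd v ≡ negFst v xor negSnd v
negThd≡negFst-xor-negSnd v000 = refl
negThd≡negFst-xor-negSnd v011 = refl
negThd≡negFst-xor-negSnd v110 = refl
negThd≡negFst-xor-negSnd v101 = refl

twist : Variant → Bool → Bool → Variant
twist v a b = mkVariant (negFst v xor a) (negSnd v xor b)

negFst-twist : ∀ v a b → negFst (twist v a b) ≡ negFst v xor a
negFst-twist v a b = negFst-mkVariant (negFst v xor a) (negSnd v xor b)

negSnd-twist : ∀ v a b → negSnd (twist v a b) ≡ negSnd v xor b
negSnd-twist v a b = negSnd-mkVariant (negFst v xor a) (negSnd v xor b)

negThd-twist : ∀ v a b → negThd (twist v a b) ≡ negThd v xor (a xor b)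
negThd-twist v a b = begin
  negThd (twist v a b)                   ≡⟨ negThd-mkVariant (negFst v xor a) (negSnd v xor b) ⟩
  (negFst v xor a) xor (negSnd v xor b)  ≡⟨ interchange (negFst v) a (negSnd v) b ⟩
  (negFst v xor negSnd v) xor (a xor b)  ≡⟨ cong (_xor (a xor b)) (sym (negThd≡negFst-xor-negSnd v)) ⟩
  negThd v xor (a xor b)                 ∎
  where open ≡-Reasoning

xor-cancelʳ : ∀ x a → (x xor a) xor a ≡ x
xor-cancelʳ x a = trans (xor-assoc x a a) (trans (cong (x xor_) (xor-same a)) (xor-identityʳ x))

twist-involutive : ∀ v a b → twist (twist v a b) a b ≡ v
twist-involutive v a b
  rewrite negFst-twist v a b | negSnd-twist v a b | xor-cancelʳ (negFst v) a | xor-cancelʳ (negSnd v) b =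
  mkVariant-neg v

twist-permutes : ∀ a b → map (λ v → twist v a b) allVariants ↭ allVariants
twist-permutes false false = ↭-refl
twist-permutes false true  = swap v011 v000 (swap v101 v110 ↭-refl)
twist-permutes true  false =
  ↭-trans (++-comm (v101 ∷ v110 ∷ []) (v011 ∷ v000 ∷ [])) (swap v011 v000 (swap v101 v110 ↭-refl))
twist-permutes true  true  = ++-comm (v110 ∷ v101 ∷ []) (v000 ∷ v011 ∷ [])

parity₃≡false : ∀ a b c → parity (a ∷ b ∷ c ∷ []) ≡ false → c ≡ a xor b
parity₃≡false false false false _ = refl
parity₃≡false false true  true  _ = refl
parity₃≡false true  false true  _ = refl
parity₃≡false true  true  false _ = refl
parity₃≡false false false true  ()
parity₃≡false false true  false ()
parity₃≡false true  false false ()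
parity₃≡false true  true  true  ()

module GraphOfFormula {n : ℕ} (φ : Formula n) where

  Vertex : Set
  Vertex = Vtx n (m φ)

  private
    Code : Set
    Code = (Fin (m φ) × Bool × Bool) ⊎ (Fin n × Bool) ⊎ (Fin (ℕ.pred n) × Fin 3)

    encode : Vertex → Code
    encode (cl p v)  = inj₁ (p , negFst v , negSnd v)
    encode (var x b) = inj₂ (inj₁ (x , b))
    encode (gad i l) = inj₂ (inj₂ (i , 0F))
    encode (gad i r) = inj₂ (inj₂ (i , 1F))
    encode (gad i s) = inj₂ (inj₂ (i , 2F))

    decode : Code → Vertex
    decode (inj₁ (p , a , b))     = cl p (mkVariant a b)
    decode (inj₂ (inj₁ (x , b)))  = var x b
    decode (inj₂ (inj₂ (i , 0F))) = gad i l
    decode (inj₂ (inj₂ (i , 1F))) = gad i r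
    decode (inj₂ (inj₂ (i , 2F))) = gad i s

    decode-encode : ∀ a → decode (encode a) ≡ a
    decode-encode (cl p v)  = cong (cl p) (mkVariant-neg v)
    decode-encode (var x b) = refl
    decode-encode (gad i l) = refl
    decode-encode (gad i r) = refl
    decode-encode (gad i s) = refl

  _≟ⱽ_ : DecidableEquality Vertex
  _≟ⱽ_ = ≡-dec-via encode decode decode-encode
    (Sumₚ.≡-dec (Prodₚ.≡-dec Fin._≟_ (Prodₚ.≡-dec Boolₚ._≟_ Boolₚ._≟_))
      (Sumₚ.≡-dec (Prodₚ.≡-dec Fin._≟_ Boolₚ._≟_) (Prodₚ.≡-dec Fin._≟_ Fin._≟_)))

  out : Vertex → List Vertex
  out (cl p v)      = var (fst (cls φ p)) (not (negFst v)) ∷ var (snd (cls φ p)) (not (negSnd v))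
                    ∷ var (thd (cls φ p)) (not (negThd v)) ∷ []
  out (var x false) = [ var x true ]
  out (var x true)  = []
  out (gad i l)     = gad i r ∷ var (lo i) false ∷ var (lo i) true ∷ []
  out (gad i r)     = gad i s ∷ var (hi i) false ∷ var (hi i) true ∷ []
  out (gad i s)     = []

  Arc⇒∈out : ∀ {a b} → Arc φ a b → b ∈ out a
  Arc⇒∈out (a-fst p v)    = here refl
  Arc⇒∈out (a-snd p v)    = there (here refl)
  Arc⇒∈out (a-thd p v)    = there (there (here refl))
  Arc⇒∈out (a-var x)      = here refl
  Arc⇒∈out (a-lr i)       = here refl
  Arc⇒∈out (a-rs i)       = here refl
  Arc⇒∈out (a-lX i false) = there (here refl)
  Arc⇒∈out (a-lX i true)  = there (there (here refl))
  Arc⇒∈out (a-rX i false) = there (here refl)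
  Arc⇒∈out (a-rX i true)  = there (there (here refl))

  ∈out⇒Arc : ∀ a {b} → b ∈ out a → Arc φ a b
  ∈out⇒Arc (cl p v)      (here refl)                 = a-fst p v
  ∈out⇒Arc (cl p v)      (there (here refl))         = a-snd p v
  ∈out⇒Arc (cl p v)      (there (there (here refl))) = a-thd p v
  ∈out⇒Arc (var x false) (here refl)                 = a-var x
  ∈out⇒Arc (gad i l)     (here refl)                 = a-lr i
  ∈out⇒Arc (gad i l)     (there (here refl))         = a-lX i false
  ∈out⇒Arc (gad i l)     (there (there (here refl))) = a-lX i true
  ∈out⇒Arc (gad i r)     (here refl)                 = a-rs i
  ∈out⇒Arc (gad i r)     (there (here refl))         = a-rX i false
  ∈out⇒Arc (gad i r)     (there (there (here refl))) = a-rX i true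

  arc? : Decidable₂ (Arc φ)
  arc? a b = map′ (∈out⇒Arc a) Arc⇒∈out (b ∈? out a)
    where open import Data.List.Membership.DecPropositional _≟ⱽ_ using (_∈?_)

  edge? : Decidable₂ (E (Gφ φ))
  edge? a b = arc? a b ⊎-dec arc? b a

  clauseVertices valueVertices gadgetVertices : List Vertex
  clauseVertices = concatMap (λ p → map (cl p) allVariants) (allFin (m φ))
  valueVertices  = concatMap (λ x → var x false ∷ var x true ∷ []) (allFin n)
  gadgetVertices = concatMap (λ i → gad i l ∷ gad i r ∷ gad i s ∷ []) (allFin (ℕ.pred n))

  ∈-allV : ∀ a → a ∈ allV (Gφ φ)
  ∈-allV (cl p v) =
    ∈-++⁺ˡ (∈-concatMap⁺ (λ p → map (cl p) allVariants) (lose (∈-allFin p) (variant∈ v)))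
    where
    variant∈ : ∀ v → cl p v ∈ map (cl p) allVariants
    variant∈ v000 = here refl
    variant∈ v011 = there (here refl)
    variant∈ v110 = there (there (here refl))
    variant∈ v101 = there (there (there (here refl)))
  ∈-allV (var x b) = ∈-++⁺ʳ clauseVertices (∈-++⁺ˡ
    (∈-concatMap⁺ (λ x → var x false ∷ var x true ∷ []) (lose (∈-allFin x) (value∈ b))))
    where
    value∈ : ∀ b → var x b ∈ var x false ∷ var x true ∷ []
    value∈ false = here refl
    value∈ true  = there (here refl)
  ∈-allV (gad i t) = ∈-++⁺ʳ clauseVertices (∈-++⁺ʳ valueVertices
    (∈-concatMap⁺ (λ i → gad i l ∷ gad i r ∷ gad i s ∷ []) (lose (∈-allFin i) (part∈ t))))
    where
    part∈ : ∀ t → gad i t ∈ gad i l ∷ gad i r ∷ gad i s ∷ []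
    part∈ l = here refl
    part∈ r = there (here refl)
    part∈ s = there (there (here refl))

  triple : Clause n → Fin 3 → Fin n
  triple C 0F = fst C
  triple C 1F = snd C
  triple C 2F = thd C

  Answers : Set
  Answers = Fin 3 → Bool

  -- Gadget vertices are never twisted, so any variable will do for them.
  pebbleVars : Vertex → Fin 3 → Fin n
  pebbleVars (cl p v)  = triple (cls φ p)
  pebbleVars (var x b) = λ _ → x
  pebbleVars (gad i t) = λ _ → lo i

  σ : Vertex → Answers → Vertex
  σ (cl p v)  β = cl p (twist v (β 0F) (β 1F))
  σ (var x b) β = var x (b xor β 0F)
  σ (gad i t) β = gad i t

  Even : Vertex → Answers → Set
  Even (cl p v)  β = β 2F ≡ β 0F xor β 1F
  Even (var x b) β = ⊤
  Even (gad i t) β = ⊤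

  Coherent : Vertex → Vertex → Answers → Answers → Set
  Coherent a b β γ = ∀ ρ ρ′ → pebbleVars a ρ ≡ pebbleVars b ρ′ → β ρ ≡ γ ρ′

  σ-involutive : ∀ a β → σ (σ a β) β ≡ a
  σ-involutive (cl p v)  β = cong (cl p) (twist-involutive v (β 0F) (β 1F))
  σ-involutive (var x b) β = cong (var x) (xor-cancelʳ b (β 0F))
  σ-involutive (gad i t) β = refl

  σ-cong : ∀ a {β γ} → β ≗ γ → σ a β ≡ σ a γ
  σ-cong (cl p v)  β≗γ = cong₂ (λ b₀ b₁ → cl p (twist v b₀ b₁)) (β≗γ 0F) (β≗γ 1F)
  σ-cong (var x b) β≗γ = cong (λ b₀ → var x (b xor b₀)) (β≗γ 0F)
  σ-cong (gad i t) β≗γ = refl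

  pebbleVars-σ : ∀ a β → pebbleVars (σ a β) ≗ pebbleVars a
  pebbleVars-σ (cl p v)  β ρ = refl
  pebbleVars-σ (var x b) β ρ = refl
  pebbleVars-σ (gad i t) β ρ = refl

  Even-σ : ∀ a {β} → Even a β → Even (σ a β) β
  Even-σ (cl p v)  ev = ev
  Even-σ (var x b) ev = tt
  Even-σ (gad i t) ev = tt

  Coherent-σ : ∀ a b {β γ} → Coherent a b β γ → Coherent (σ a β) (σ b γ) β γ
  Coherent-σ a b {β} {γ} coh ρ ρ′ eq =
    coh ρ ρ′ (trans (sym (pebbleVars-σ a β ρ)) (trans eq (pebbleVars-σ b γ ρ′)))

  Coherent-sym : ∀ {a b β γ} → Coherent a b β γ → Coherent b a γ β
  Coherent-sym coh ρ ρ′ eq = sym (coh ρ′ ρ (sym eq))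

  σ-≡ : ∀ {a b β γ} → Coherent a b β γ → a ≡ b → σ a β ≡ σ b γ
  σ-≡ {a} coh refl = σ-cong a (λ ρ → coh ρ ρ refl)

  not-twisted : ∀ ν {ν′ δ g} → ν′ ≡ ν xor δ → δ ≡ g → not ν′ ≡ not ν xor g
  not-twisted ν refl refl = not-distribˡ-xor ν _

  σ-arc : ∀ {a b β γ} → Coherent a b β γ → Even a β → Arc φ a b → E (Gφ φ) (σ a β) (σ b γ)
  σ-arc coh ev (a-fst p v) =
    inj₁ (subst (Arc φ _ ∘ var _) (not-twisted (negFst v) (negFst-twist v _ _) (coh 0F 0F refl)) (a-fst p _))
  σ-arc coh ev (a-snd p v) =
    inj₁ (subst (Arc φ _ ∘ var _) (not-twisted (negSnd v) (negSnd-twist v _ _) (coh 1F 0F refl)) (a-snd p _))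
  σ-arc coh ev (a-thd p v) =
    inj₁ (subst (Arc φ _ ∘ var _) (not-twisted (negThd v) negThd≡ (coh 2F 0F refl)) (a-thd p _))
    where negThd≡ = trans (negThd-twist v _ _) (cong (negThd v xor_) (sym ev))
  σ-arc {β = β} {γ} coh ev (a-var x) with β 0F | γ 0F | coh 0F 0F refl
  ... | false | .false | refl = inj₁ (a-var x)
  ... | true  | .true  | refl = inj₂ (a-var x)
  σ-arc coh ev (a-lr i)   = inj₁ (a-lr i)
  σ-arc coh ev (a-rs i)   = inj₁ (a-rs i)
  σ-arc coh ev (a-lX i b) = inj₁ (a-lX i _)
  σ-arc coh ev (a-rX i b) = inj₁ (a-rX i _)

  σ-edge : ∀ {a b β γ} → Coherent a b β γ → Even a β → Even b γ
         → E (Gφ φ) a b → E (Gφ φ) (σ a β) (σ b γ)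
  σ-edge coh eva evb (inj₁ arc) = σ-arc coh eva arc
  σ-edge {a} {b} coh eva evb (inj₂ arc) = Sum.swap (σ-arc (Coherent-sym {a} {b} coh) evb arc)

  -- σ is an involution, so each reverse direction is the forward one for the twisted vertices.
  σ-preserves : ∀ {a b β γ} → Coherent a b β γ → Even a β → Even b γ
              → (a ≡ b ⇔ σ a β ≡ σ b γ) × (E (Gφ φ) a b ⇔ E (Gφ φ) (σ a β) (σ b γ))
  σ-preserves {a} {b} {β} {γ} coh eva evb =
    mk⇔ (σ-≡ coh) (λ eq → subst₂ _≡_ (σ-involutive a β) (σ-involutive b γ) (σ-≡ coh′ eq)) ,
    mk⇔ (σ-edge coh eva evb) (λ e → subst₂ (E (Gφ φ)) (σ-involutive a β) (σ-involutive b γ)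
                                        (σ-edge coh′ (Even-σ a eva) (Even-σ b evb) e))
    where coh′ = Coherent-σ a b coh

  σ-permutes : ∀ (ans : (Fin 3 → Fin n) → Answers)
             → map (λ a → σ a (ans (pebbleVars a))) (allV (Gφ φ)) ↭ allV (Gφ φ)
  σ-permutes ans = ↭-trans (↭-reflexive (map-++ π clauseVertices (valueVertices ++ gadgetVertices)))
    (++⁺ (map-concatMap-↭ π _ clauseBlock (allFin (m φ)))
      (↭-trans (↭-reflexive (map-++ π valueVertices gadgetVertices))
        (++⁺ (map-concatMap-↭ π _ valueBlock (allFin n))
             (map-concatMap-↭ π _ (λ _ → ↭-refl) (allFin (ℕ.pred n))))))
    where
    π : Vertex → Vertex
    π a = σ a (ans (pebbleVars a))
    clauseBlock : ∀ p → map π (map (cl p) allVariants) ↭ map (cl p) allVariants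
    clauseBlock p = map⁺ (cl p) (twist-permutes _ _)
    valueBlock : ∀ x → map π (var x false ∷ var x true ∷ []) ↭ var x false ∷ var x true ∷ []
    valueBlock x with ans (λ _ → x) 0F
    ... | false = ↭-refl
    ... | true  = swap _ _ ↭-refl

module PebbleGame {K nv : ℕ} {ψ : System nv} (LC : LocallyConsistent K ψ) where

  Safe : Position K nv → Set
  Safe = proj₁ LC

  private
    safe-initial : Safe initial
    safe-initial = proj₁ (proj₂ LC)

    safe⇒¬wins : ∀ {pos} → Safe pos → ¬ SpoilerWins ψ pos
    safe⇒¬wins = proj₁ (proj₂ (proj₂ LC)) _

    answer : ∀ {pos} → Safe pos → ∀ j x → Σ Bool λ b → Safe (move pos j x b)
    answer = proj₂ (proj₂ (proj₂ LC)) _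

  move-here : ∀ (pos : Position K nv) j x b → move pos j x b j ≡ just (x , b)
  move-here pos j x b with j Fin.≟ j
  ... | yes _  = refl
  ... | no j≢j = contradiction refl j≢j

  move-elsewhere : ∀ (pos : Position K nv) {j j′} x b → j′ ≢ j → move pos j x b j′ ≡ pos j′
  move-elsewhere pos {j} {j′} x b j′≢j with j′ Fin.≟ j
  ... | yes j′≡j = contradiction j′≡j j′≢j
  ... | no _     = refl

  consistent : ∀ {pos} → Safe pos → ∀ p p′ {x b b′}
             → pos p ≡ just (x , b) → pos p′ ≡ just (x , b′) → b ≡ b′
  consistent safe p p′ {b = b} {b′} at-p at-p′ with b Boolₚ.≟ b′
  ... | yes b≡b′ = b≡b′
  ... | no b≢b′  = contradiction (inj₁ (p , p′ , _ , b , b′ , at-p , at-p′ , b≢b′)) (safe⇒¬wins safe)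

  satisfies : ∀ {pos e bs} → Safe pos → e ∈ ψ → Reads pos (vars e) bs → parity bs ≡ rhs e
  satisfies {e = e} {bs} safe e∈ψ reads with parity bs Boolₚ.≟ rhs e
  ... | yes sat  = sat
  ... | no unsat = contradiction (inj₂ (e , e∈ψ , bs , reads , unsat)) (safe⇒¬wins safe)

  record Placement (pos : Position K nv) {m} (q : Fin m → Fin K) (y : Fin m → Fin nv) : Set where
    field
      position  : Position K nv
      safe      : Safe position
      answers   : Fin m → Bool
      placed    : ∀ ρ → position (q ρ) ≡ just (y ρ , answers ρ)
      untouched : ∀ p → (∀ ρ → p ≢ q ρ) → position p ≡ pos p

  place : ∀ {pos} → Safe pos → ∀ {m} (q : Fin m → Fin K) → Injective _≡_ _≡_ q → (y : Fin m → Fin nv)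
        → Placement pos q y
  place {pos} pos-safe {zero} q q-inj y = record
    { position = pos ; safe = pos-safe ; answers = λ () ; placed = λ () ; untouched = λ _ _ → refl }
  place {pos} pos-safe {suc m} q q-inj y = record
    { position  = move before (q 0F) (y 0F) b
    ; safe      = proj₂ (answer (Placement.safe rest) (q 0F) (y 0F))
    ; answers   = b ◃ Placement.answers rest
    ; placed    = λ { zero    → move-here before (q 0F) (y 0F) b
                    ; (suc ρ) → trans (move-elsewhere before (y 0F) b
                                         (λ eq → Finₚ.0≢1+n (q-inj {0F} {suc ρ} (sym eq))))
                                      (Placement.placed rest ρ) }
    ; untouched = λ p p∉q → trans (move-elsewhere before (y 0F) b (p∉q 0F))
                                  (Placement.untouched rest p (p∉q ∘ suc))
    }
    where
    rest   = place pos-safe (q ∘ suc) (λ {ρ} {ρ′} eq → Finₚ.suc-injective (q-inj {suc ρ} {suc ρ′} eq)) (y ∘ suc)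
    before = Placement.position rest
    b      = proj₁ (answer (Placement.safe rest) (q 0F) (y 0F))

  place-initial : ∀ (x : Fin nv) → Placement initial id (λ _ → x)
  place-initial x = place safe-initial id id (λ _ → x)

module Twisting {n : ℕ} (φ : Formula n) (k : ℕ) (i₀ : Fin n)
                (LC : LocallyConsistent (3 * (k + 1)) (system+ φ i₀)) where
  open GraphOfFormula φ
  open PebbleGame LC
  open WeisfeilerLeman (Gφ φ) k _≟ⱽ_ edge? ∈-allV

  -- Block inj₁ j holds the three pebbles of entry j of a tuple; the spare block holds three more.
  Block : Set
  Block = Fin k ⊎ Fin 1

  spare : Block
  spare = inj₂ 0F

  pebble : Fin 3 → Block → Fin (3 * (k + 1))
  pebble ρ blk = Fin.combine ρ (Fin.join k 1 blk)

  pebble-injective : ∀ ρ blk ρ′ blk′ → pebble ρ blk ≡ pebble ρ′ blk′ → ρ ≡ ρ′ × blk ≡ blk′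
  pebble-injective ρ blk ρ′ blk′ eq with ρ≡ρ′ , join≡ ← Finₚ.combine-injective ρ _ ρ′ _ eq =
    ρ≡ρ′ , trans (sym (Finₚ.splitAt-join k 1 blk))
                 (trans (cong (Fin.splitAt k) join≡) (Finₚ.splitAt-join k 1 blk′))

  pebble-injectiveˡ : ∀ blk → Injective _≡_ _≡_ (λ ρ → pebble ρ blk)
  pebble-injectiveˡ blk {ρ} {ρ′} eq = proj₁ (pebble-injective ρ blk ρ′ blk eq)

  pebbles-disjoint : ∀ {blk blk′} → blk ≢ blk′ → ∀ ρ ρ′ → pebble ρ blk ≢ pebble ρ′ blk′
  pebbles-disjoint blk≢blk′ ρ ρ′ eq = blk≢blk′ (proj₂ (pebble-injective ρ _ ρ′ _ eq))

  Holds : Position (3 * (k + 1)) n → Block → Vertex → Answers → Set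
  Holds pos blk a β = ∀ ρ → pos (pebble ρ blk) ≡ just (pebbleVars a ρ , β ρ)

  Twisted : Position (3 * (k + 1)) n → Block → Vertex → Vertex → Set
  Twisted pos blk a b = Σ Answers λ β → Holds pos blk a β × b ≡ σ a β

  Matched : Tup → Tup → Set
  Matched u v = Σ (Position (3 * (k + 1)) n) λ pos → Safe pos × ∀ j → Twisted pos (inj₁ j) (u j) (v j)

  safe⇒true : ∀ {pos} → Safe pos → ∀ p {b} → pos p ≡ just (i₀ , b) → b ≡ true
  safe⇒true _    p {true}  _  = refl
  safe⇒true safe p {false} at = satisfies safe (∈-++⁺ʳ (system φ) (here refl)) ((p , at) ∷ [])

  Holds⇒Even : ∀ {pos} → Safe pos → ∀ blk a {β} → Holds pos blk a β → Even a β
  Holds⇒Even safe blk (cl p v) {β} h = parity₃≡false (β 0F) (β 1F) (β 2F)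
    (satisfies safe (∈-++⁺ˡ (∈-map⁺ (λ p → clauseEq (cls φ p)) (∈-allFin p)))
      ((pebble 0F blk , h 0F) ∷ (pebble 1F blk , h 1F) ∷ (pebble 2F blk , h 2F) ∷ []))
  Holds⇒Even safe blk (var x b) h = tt
  Holds⇒Even safe blk (gad i t) h = tt

  Holds⇒Coherent : ∀ {pos} → Safe pos → ∀ blk blk′ a b {β γ} → Holds pos blk a β → Holds pos blk′ b γ
                 → Coherent a b β γ
  Holds⇒Coherent {pos} safe blk blk′ a b {β} {γ} h h′ ρ ρ′ eq =
    consistent safe (pebble ρ blk) (pebble ρ′ blk′) (h ρ)
      (subst (λ y → pos (pebble ρ′ blk′) ≡ just (y , γ ρ′)) (sym eq) (h′ ρ′))

  matched⇒SameType : ∀ {u v} → Matched u v → SameType (Gφ φ) {k} u v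
  matched⇒SameType {u} {v} (pos , safe , twisted) i j
    with βi , hi , vi≡ ← twisted i | βj , hj , vj≡ ← twisted j =
    subst₂ (λ b b′ → (u i ≡ u j ⇔ b ≡ b′) × (E (Gφ φ) (u i) (u j) ⇔ E (Gφ φ) b b′))
           (sym vi≡) (sym vj≡)
      (σ-preserves (Holds⇒Coherent safe (inj₁ i) (inj₁ j) (u i) (u j) hi hj)
                   (Holds⇒Even safe (inj₁ i) (u i) hi) (Holds⇒Even safe (inj₁ j) (u j) hj))

  matched-bijection : ∀ {u v} → Matched u v
                    → Σ (Vertex → Vertex) λ π → map π (allV (Gφ φ)) ↭ allV (Gφ φ)
                      × (∀ j x → Matched (upd {Gφ φ} u j x) (upd {Gφ φ} v j (π x)))
  matched-bijection {u} {v} (pos , safe , twisted) = π , σ-permutes spareAnswers , matched-upd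
    where
    open Placement using (position; answers; placed; untouched)
    atSpare : (y : Fin 3 → Fin n) → Placement pos (λ ρ → pebble ρ spare) y
    atSpare = place safe (λ ρ → pebble ρ spare) (pebble-injectiveˡ spare)
    spareAnswers : (Fin 3 → Fin n) → Answers
    spareAnswers y = answers (atSpare y)
    -- Independent of the entry j being replaced, as the bijective game requires.
    π : Vertex → Vertex
    π a = σ a (spareAnswers (pebbleVars a))
    matched-upd : ∀ j x → Matched (upd {Gφ φ} u j x) (upd {Gφ φ} v j (π x))
    matched-upd j x = position Q , Placement.safe Q , twisted′
      where
      P = atSpare (pebbleVars x)
      Q = place (Placement.safe P) (λ ρ → pebble ρ (inj₁ j)) (pebble-injectiveˡ (inj₁ j)) (pebbleVars x)
      agree : answers Q ≗ answers P
      agree ρ = consistent (Placement.safe Q) (pebble ρ (inj₁ j)) (pebble ρ spare) (placed Q ρ)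
        (trans (untouched Q (pebble ρ spare) (pebbles-disjoint {spare} {inj₁ j} (λ ()) ρ)) (placed P ρ))
      twisted′ : ∀ j′ → Twisted (position Q) (inj₁ j′) (upd {Gφ φ} u j x j′) (upd {Gφ φ} v j (π x) j′)
      twisted′ j′ with j′ Fin.≟ j
      ... | yes refl = answers Q , placed Q , σ-cong x (sym ∘ agree)
      ... | no j′≢j with β , h , vj′≡ ← twisted j′ = β , held , vj′≡
        where
        held : Holds (position Q) (inj₁ j′) (u j′) β
        held ρ = trans (untouched Q (pebble ρ (inj₁ j′)) (pebbles-disjoint (j′≢j ∘ Sumₚ.inj₁-injective) ρ))
                  (trans (untouched P (pebble ρ (inj₁ j′)) (pebbles-disjoint {inj₁ j′} {spare} (λ ()) ρ)) (h ρ))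

  matched-initial : Matched (λ _ → var i₀ false) (λ _ → var i₀ true)
  matched-initial = position P , Placement.safe P , λ j → (λ _ → true) , held j , refl
    where
    open Placement using (position; placed)
    P = place-initial i₀
    held : ∀ j → Holds (position P) (inj₁ j) (var i₀ false) (λ _ → true)
    held j ρ = trans (placed P p) (cong (λ b → just (i₀ , b)) (safe⇒true (Placement.safe P) p (placed P p)))
      where p = pebble ρ (inj₁ j)

  matched-bisimulation : Bisimulation Matched
  matched-bisimulation = record { sameType = matched⇒SameType ; bijection = matched-bijection }

-- The argument works for every k.
lemma2 : ∀ {n : ℕ} (φ : Formula n) (k : ℕ) → 2 ≤ k → (i : Fin n)
         → LocallyConsistent (3 * (k + 1)) (system+ φ i)
         → WLEquiv (Gφ φ) k (λ _ → var i false) (λ _ → var i true)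
lemma2 φ k _ i LC = bisimilar⇒WLEquiv matched-bisimulation matched-initial
  where
  open GraphOfFormula φ
  open WeisfeilerLeman (Gφ φ) k _≟ⱽ_ edge? ∈-allV
  open Twisting φ k i LC
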